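{- Let $r=2k+1$ with $k\geq 1$. Let $\mathcal{S}=(S;S_1,\ldots,S_m)$ be an instance of hypergraph 2-colorability with $S=\{x_1,\ldots,x_n\}$ and $m\geq 1$, and fix a coloring of $S$ with colors $A,B$ in which every $S_j$ contains elements of both colors. Let $K_{\mathcal{S}}$, $H_{\mathcal{S}}$ and $G_{\mathcal{S}}$ be the graphs defined below. Then $G_{\mathcal{S}}=H_{\mathcal{S}}^r$. Vertex set: vertices $S_1,\ldots,S_m$, $x_1,\ldots,x_n$, $A$, $B$, $X$; vertices $T_{i,j}^{(l)}$ for each pair $(i,j)$ with $x_i\in S_j$ and $l=1,\ldots,k-1$; vertices $P_i^{(l)}$ for each $i$ and $l=1,\ldots,k-1$; vertices $S_j^{(l)}$ for each $j$ and $l=1,\ldots,r$. With the conventions $T_{i,j}^{(0)}=S_j$, $T_{i,j}^{(k)}=x_i$, $P_i^{(0)}=x_i$, the graph $K_{\mathcal{S}}$ has edges: the path $S_j-T_{i,j}^{(1)}-\cdots-T_{i,j}^{(k-1)}-x_i$ whenever $x_i\in S_j$; the path $x_i-P_i^{(1)}-\cdots-P_i^{(k-1)}$ for each $i$; edges $X-x_i$ for all $i$; and the path $S_j-S_j^{(1)}-\cdots-S_j^{(r)}$ for each $j$. $H_{\mathcal{S}}$ is $K_{\mathcal{S}}$ plus the edge $P_i^{(k-1)}-A$ for each $x_i$ of color $A$ and $P_i^{(k-1)}-B$ for each $x_i$ of color $B$. Finally $G_{\mathcal{S}}=K_{\mathcal{S}}^r\cup E_{\mathcal{S}}$, where $E_{\mathcal{S}}$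 consists of all edges from $A$ and from $B$ to each of the vertices $X$, $x_i$, $S_j$, $T_{i,j}^{(l)}$, $P_i^{(l)}$ and $S_j^{(1)}$ (all possible $i,j,l$).
   Context: All graphs are simple and undirected. For a graph $H$ and positive integer $r$, $H^r$ is the graph on $V(H)$ in which two distinct vertices are adjacent iff their distance in $H$ is at most $r$; the union of a graph with an edge set means adding those edges. An instance of hypergraph 2-colorability consists of a finite set $S$ and subsets $S_1,\ldots,S_m$ of $S$; a 2-coloring assigns each element one of two colors so that each $S_j$ has elements of both colors. -}

module Defs where

open import Data.Nat using (ℕ; zero; suc; _+_; _*_; _∸_; _≤_; _<_)
open import Data.Nat.Properties using (_<?_)
open import Data.Fin using (Fin; fromℕ<)
open import Data.Fin.Subset using (Subset; _∈_)
open import Data.Product using (Σ; _×_)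
open import Data.Sum using (_⊎_)
open import Relation.Nullary using (¬_; yes; no)
open import Relation.Binary.PropositionalEquality using (_≡_)

Sym : {V : Set} → (V → V → Set) → V → V → Set
Sym E u v = E u v ⊎ E v u

data Walk {V : Set} (E : V → V → Set) : V → V → ℕ → Set where
  nil  : ∀ {u} → Walk E u u 0
  cons : ∀ {u w v ℓ} → E u w → Walk E w v ℓ → Walk E u v (suc ℓ)

DistLe : {V : Set} → (V → V → Set) → ℕ → V → V → Set
DistLe E r u v = Σ ℕ (λ ℓ → ℓ ≤ r × Walk E u v ℓ)

Power : {V : Set} → (V → V → Set) → ℕ → V → V → Set
Power E r u v = ¬ (u ≡ v) × DistLe E r u v

data Colour : Set where
  colA colB : Colour

-- Superscript l ∈ {1..k-1} is encoded by an index in Fin (k ∸ 1)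
-- (index t stands for l = t+1); l ∈ {1..r} by Fin r likewise.

module Construction (k n m : ℕ) (Ss : Fin m → Subset n) (col : Fin n → Colour) where

  r : ℕ
  r = 2 * k + 1

  data V : Set where
    sV   : Fin m → V
    xV   : Fin n → V
    AV BV XV : V
    tV   : (i : Fin n) (j : Fin m) → .(i ∈ Ss j) → Fin (k ∸ 1) → V
    pV   : Fin n → Fin (k ∸ 1) → V
    slV  : Fin m → Fin r → V

  -- T_{i,j}^{(l)} with conventions T^{(0)} = S_j, T^{(k)} = x_i (for l ≤ k)
  tv : (i : Fin n) (j : Fin m) → .(i ∈ Ss j) → ℕ → V
  tv i j p zero = sV j
  tv i j p (suc l) with l <? (k ∸ 1)
  ... | yes q = tV i j p (fromℕ< q)
  ... | no _  = xV i

  -- P_i^{(l)} with convention P^{(0)} = x_i (meaningful for l ≤ k-1)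
  pv : Fin n → ℕ → V
  pv i zero = xV i
  pv i (suc l) with l <? (k ∸ 1)
  ... | yes q = pV i (fromℕ< q)
  ... | no _  = xV i

  -- S_j^{(l)} with S_j^{(0)} = S_j (meaningful for l ≤ r)
  sv : Fin m → ℕ → V
  sv j zero = sV j
  sv j (suc l) with l <? r
  ... | yes q = slV j (fromℕ< q)
  ... | no _  = sV j

  data KE : V → V → Set where
    tpath : ∀ i j (p : i ∈ Ss j) l → l < k → KE (tv i j p l) (tv i j p (suc l))
    ppath : ∀ i l → suc l < k → KE (pv i l) (pv i (suc l))
    xX    : ∀ i → KE XV (xV i)
    spath : ∀ j l → l < r → KE (sv j l) (sv j (suc l))

  K : V → V → Set
  K = Sym KE

  data HE : V → V → Set where
    kE : ∀ {u v} → KE u v → HE u v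
    aE : ∀ i → col i ≡ colA → HE (pv i (k ∸ 1)) AV
    bE : ∀ i → col i ≡ colB → HE (pv i (k ∸ 1)) BV

  H : V → V → Set
  H = Sym HE

  data Target : V → Set where
    tX : Target XV
    tx : ∀ i → Target (xV i)
    tS : ∀ j → Target (sV j)
    tT : ∀ i j .(p : i ∈ Ss j) l → Target (tV i j p l)
    tP : ∀ i l → Target (pV i l)
    tS1 : ∀ j (q : 0 < r) → Target (slV j (fromℕ< q))

  data EE : V → V → Set where
    aT : ∀ {v} → Target v → EE AV v
    bT : ∀ {v} → Target v → EE BV v

  G : V → V → Set
  G u v = Power K r u v ⊎ Sym EE u v

module Submission where

-- Call A and B the hubs (hub colA = A, hub colB = B), and write K, H for
-- the edge relations of K_S, H_S.  For each colour c we use a potential  height c : V → ℕ, which is the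
-- H-distance from hub c: it vanishes at hub c and changes by at most one
-- along every H-edge (it is 1-Lipschitz), hence bounds walk lengths from
-- below.
--
--  • G ⊆ H^r.  K-walks are H-walks, and every E_S-neighbour of a hub is
--    reached from it by an explicit H-walk of length ≤ r.
--  • H^r ⊆ G.  A short walk leaving a hub ends where the height is ≤ r,
--    i.e. at an E_S-neighbour.  A short walk between non-hubs either avoids
--    the hubs (so it is a K-walk) or passes through hub c; then
--    height c u + height c v ≤ r, and routing through X in K is short enough.

open import Defs
open import Data.Nat using (ℕ; zero; suc; _+_; _*_; _∸_; _≤_; _<_; z≤n; s≤s; s≤s⁻¹)
open import Data.Nat.Properties
open import Data.Nat.Tactic.RingSolver using (solve-∀)
open import Data.Fin using (Fin; toℕ; fromℕ<)
open import Data.Fin.Properties using (toℕ-fromℕ<; fromℕ<-toℕ; toℕ<n)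
open import Data.Fin.Subset using (Subset; _∈_)
open import Data.Fin.Subset.Properties using (_∈?_)
open import Data.Product using (Σ; _×_; _,_; proj₂)
open import Data.Sum using (_⊎_; inj₁; inj₂; swap) renaming (map to ⊎-map; map₂ to ⊎-map₂)
open import Data.Empty using (⊥-elim)
open import Function using (_∘_)
open import Function.Bundles using (_⇔_; mk⇔)
open import Relation.Nullary using (¬_; yes; no)
open import Relation.Nullary.Decidable using (recompute)
open import Relation.Unary using (Decidable)
open import Relation.Binary.PropositionalEquality

module _ {V : Set} where

  snoc : ∀ {E : V → V → Set} {u v w ℓ} → Walk E u v ℓ → E v w → Walk E u w (suc ℓ)
  snoc nil e = cons e nil
  snoc (cons e′ w) e = cons e′ (snoc w e)

  infixr 5 _++ʷ_
  _++ʷ_ : ∀ {E : V → V → Set} {u v w a b} → Walk E u v a → Walk E v w b → Walk E u w (a + b)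
  nil ++ʷ w = w
  cons e w ++ʷ w′ = cons e (w ++ʷ w′)

  reverse : ∀ {E : V → V → Set} {u v ℓ} → Walk (Sym E) u v ℓ → Walk (Sym E) v u ℓ
  reverse nil = nil
  reverse (cons e w) = snoc (reverse w) (swap e)

  map-walk : ∀ {E F : V → V → Set} → (∀ {a b} → E a b → F a b) → ∀ {u v ℓ} → Walk E u v ℓ → Walk F u v ℓ
  map-walk h nil = nil
  map-walk h (cons e w) = cons (h e) (map-walk h w)

  data Visit (E : V → V → Set) (P : V → Set) (u v : V) : ℕ → Set where
    visit : ∀ {w a b} → P w → Walk E u w a → Walk E w v b → Visit E P u v (a + b)

  avoid-or-visit : ∀ {E F : V → V → Set} {P : V → Set} → Decidable P
    → (∀ {u w} → E u w → ¬ P u → ¬ P w → F u w)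
    → ∀ {u v ℓ} → ¬ P u → Walk E u v ℓ → Walk F u v ℓ ⊎ Visit E P u v ℓ
  avoid-or-visit P? restrict ¬Pu nil = inj₁ nil
  avoid-or-visit P? restrict ¬Pu (cons {w = w} e rest) with P? w
  ... | yes Pw = inj₂ (visit Pw (cons e nil) rest)
  ... | no ¬Pw with avoid-or-visit P? restrict ¬Pw rest
  ...   | inj₁ walk = inj₁ (cons (restrict e ¬Pu ¬Pw) walk)
  ...   | inj₂ (visit Pm w₁ w₂) = inj₂ (visit Pm (cons e w₁) w₂)

Near : ℕ → ℕ → Set
Near a b = a ≤ suc b × b ≤ suc a

near-sym : ∀ {a b} → Near a b → Near b a
near-sym (p , q) = q , p

near-suc : ∀ a → Near a (suc a)
near-suc a = ≤-trans (n≤1+n a) (n≤1+n (suc a)) , ≤-refl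

+-near : ∀ a l → Near (a + l) (a + suc l)
+-near a l = subst (Near (a + l)) (sym (+-suc a l)) (near-suc (a + l))

∸-near : ∀ a l → l < a → Near (a ∸ l) (a ∸ suc l)
∸-near a l l<a = subst (λ x → Near x (a ∸ suc l)) (sym (+-∸-assoc 1 l<a)) (near-sym (near-suc _))

module _ {V : Set} where

  Lipschitz : (V → V → Set) → (V → ℕ) → Set
  Lipschitz E f = ∀ {u w} → E u w → Near (f u) (f w)

  lipschitz-sym : ∀ {E f} → Lipschitz E f → Lipschitz (Sym E) f
  lipschitz-sym lip (inj₁ e) = lip e
  lipschitz-sym lip (inj₂ e) = near-sym (lip e)

  walk-bound : ∀ {E f} → Lipschitz E f → ∀ {u v ℓ} → Walk E u v ℓ → f v ≤ f u + ℓ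
  walk-bound {f = f} lip {u} nil = m≤m+n (f u) 0
  walk-bound {f = f} lip {u} {v} (cons {w = w} {ℓ = ℓ} e rest) = begin
    f v           ≤⟨ walk-bound lip rest ⟩
    f w + ℓ       ≤⟨ +-monoˡ-≤ ℓ (proj₂ (lip e)) ⟩
    suc (f u + ℓ) ≡⟨ sym (+-suc (f u) ℓ) ⟩
    f u + suc ℓ   ∎
    where open ≤-Reasoning

r≡ : ∀ k → 2 * k + 1 ≡ suc (k + k)
r≡ = solve-∀

k+k≡2k : ∀ k → k + k ≡ 2 * k
k+k≡2k k = cong (k +_) (sym (+-identityʳ k))

-- Two legs out of X, each of length at most k or at most (height + 1 - k),
-- fit into r when the (positive) heights sum to at most r.
legs-fit : ∀ k {a b fa fb} → 1 ≤ k → 1 ≤ fa → 1 ≤ fb → fa + fb ≤ 2 * k + 1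
  → (a ≤ k ⊎ a + k ≤ suc fa) → (b ≤ k ⊎ b + k ≤ suc fb) → a + b ≤ 2 * k + 1
legs-fit k _ _ _ _ (inj₁ a≤k) (inj₁ b≤k) =
  ≤-trans (+-mono-≤ a≤k b≤k) (≤-trans (n≤1+n (k + k)) (≤-reflexive (sym (r≡ k))))
legs-fit k {a} {b} {fa} {fb} _ _ fb≥1 sum≤r (inj₂ far) (inj₁ b≤k) = begin
  a + b     ≤⟨ +-monoʳ-≤ a b≤k ⟩
  a + k     ≤⟨ far ⟩
  suc fa    ≡⟨ +-comm 1 fa ⟩
  fa + 1    ≤⟨ +-monoʳ-≤ fa fb≥1 ⟩
  fa + fb   ≤⟨ sum≤r ⟩
  2 * k + 1 ∎
  where open ≤-Reasoning
legs-fit k {a} {b} {fa} {fb} k≥1 fa≥1 fb≥1 sum≤r (inj₁ a≤k) (inj₂ far) =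
  subst (_≤ 2 * k + 1) (+-comm b a)
    (legs-fit k k≥1 fb≥1 fa≥1 (subst (_≤ 2 * k + 1) (+-comm fa fb) sum≤r) (inj₂ far) (inj₁ a≤k))
legs-fit k {a} {b} {fa} {fb} k≥1 _ _ sum≤r (inj₂ far₁) (inj₂ far₂) =
  ≤-trans (+-cancelʳ-≤ (2 * k) (a + b) 3 both) (+-monoˡ-≤ 1 (*-monoʳ-≤ 2 k≥1))
  where
  regroup : ∀ a b k → a + k + (b + k) ≡ a + b + 2 * k
  regroup = solve-∀
  regroup′ : ∀ fa fb → suc fa + suc fb ≡ 2 + (fa + fb)
  regroup′ = solve-∀
  regroup″ : ∀ k → 2 + (2 * k + 1) ≡ 3 + 2 * k
  regroup″ = solve-∀
  both : a + b + 2 * k ≤ 3 + 2 * k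
  both = begin
    a + b + 2 * k       ≡⟨ sym (regroup a b k) ⟩
    a + k + (b + k)     ≤⟨ +-mono-≤ far₁ far₂ ⟩
    suc fa + suc fb     ≡⟨ regroup′ fa fb ⟩
    2 + (fa + fb)       ≤⟨ +-monoʳ-≤ 2 sum≤r ⟩
    2 + (2 * k + 1)     ≡⟨ regroup″ k ⟩
    3 + 2 * k           ∎
    where open ≤-Reasoning

-- The construction, for k = suc k₀ and a nonempty family of sets (j₀ is
-- one of them) each containing both colours.

module Proof (k₀ n m : ℕ) (Ss : Fin m → Subset n) (col : Fin n → Colour)
  (hA : ∀ j → Σ (Fin n) (λ i → i ∈ Ss j × col i ≡ colA))
  (hB : ∀ j → Σ (Fin n) (λ i → i ∈ Ss j × col i ≡ colB))
  (j₀ : Fin m) where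

  open Construction (suc k₀) n m Ss col

  k : ℕ
  k = suc k₀

  member : ∀ c j → Σ (Fin n) (λ i → i ∈ Ss j × col i ≡ c)
  member colA = hA
  member colB = hB

  hub : Colour → V
  hub colA = AV
  hub colB = BV

  data IsHub : V → Set where
    isA : IsHub AV
    isB : IsHub BV

  isHub? : Decidable IsHub
  isHub? AV = yes isA
  isHub? BV = yes isB
  isHub? XV = no λ ()
  isHub? (sV _) = no λ ()
  isHub? (xV _) = no λ ()
  isHub? (tV _ _ _ _) = no λ ()
  isHub? (pV _ _) = no λ ()
  isHub? (slV _ _) = no λ ()

  kH : ∀ {u w} → K u w → H u w
  kH = ⊎-map kE kE

  restrict-HE : ∀ {u w} → HE u w → ¬ IsHub w → KE u w
  restrict-HE (kE e) _ = e
  restrict-HE (aE _ _) ¬hub = ⊥-elim (¬hub isA)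
  restrict-HE (bE _ _) ¬hub = ⊥-elim (¬hub isB)

  restrict-H : ∀ {u w} → H u w → ¬ IsHub u → ¬ IsHub w → K u w
  restrict-H (inj₁ e) _ ¬hub = inj₁ (restrict-HE e ¬hub)
  restrict-H (inj₂ e) ¬hub _ = inj₂ (restrict-HE e ¬hub)

  tv-last : ∀ i j .(p : i ∈ Ss j) → tv i j p k ≡ xV i
  tv-last i j p with k₀ <? k₀
  ... | yes k₀<k₀ = ⊥-elim (<-irrefl refl k₀<k₀)
  ... | no _ = refl

  tv-inner : ∀ i j .(p : i ∈ Ss j) (t : Fin k₀) → tv i j p (suc (toℕ t)) ≡ tV i j p t
  tv-inner i j p t with toℕ t <? k₀
  ... | yes q = cong (tV i j p) (fromℕ<-toℕ t q)
  ... | no ¬q = ⊥-elim (¬q (toℕ<n t))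

  pv-inner : ∀ i (t : Fin k₀) → pv i (suc (toℕ t)) ≡ pV i t
  pv-inner i t with toℕ t <? k₀
  ... | yes q = cong (pV i) (fromℕ<-toℕ t q)
  ... | no ¬q = ⊥-elim (¬q (toℕ<n t))

  sv-inner : ∀ j (t : Fin r) → sv j (suc (toℕ t)) ≡ slV j t
  sv-inner j t with toℕ t <? r
  ... | yes q = cong (slV j) (fromℕ<-toℕ t q)
  ... | no ¬q = ⊥-elim (¬q (toℕ<n t))

  -- The potential: height c v = dist_H(hub c, v)

  -- height of x_i (l = 0) and P_i^{(l)} when x_i has colour d:
  -- k - l if d = c, and k + 2 + l otherwise
  pathHeight : Colour → Colour → ℕ → ℕ
  pathHeight colA colA l = k ∸ l
  pathHeight colB colB l = k ∸ l
  pathHeight colA colB l = l + suc (suc k)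
  pathHeight colB colA l = l + suc (suc k)

  hubHeight : Colour → Colour → ℕ
  hubHeight colA colA = 0
  hubHeight colB colB = 0
  hubHeight colA colB = 2 * k + 2
  hubHeight colB colA = 2 * k + 2

  height : Colour → V → ℕ
  height c AV = hubHeight c colA
  height c BV = hubHeight c colB
  height c XV = suc k
  height c (xV i) = pathHeight c (col i) 0
  height c (pV i t) = pathHeight c (col i) (suc (toℕ t))
  height c (tV i j p t) = 2 * k ∸ suc (toℕ t)
  height c (sV j) = 2 * k
  height c (slV j t) = 2 * k + suc (toℕ t)

  height-tv : ∀ c i j .(p : i ∈ Ss j) l → l < k → height c (tv i j p l) ≡ 2 * k ∸ l
  height-tv c i j p zero _ = refl
  height-tv c i j p (suc l) l<k with l <? k₀
  ... | yes q = cong (λ x → 2 * k ∸ suc x) (toℕ-fromℕ< q)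
  ... | no ¬q = ⊥-elim (¬q (s≤s⁻¹ l<k))

  height-pv : ∀ c i l → l < k → height c (pv i l) ≡ pathHeight c (col i) l
  height-pv c i zero _ = refl
  height-pv c i (suc l) l<k with l <? k₀
  ... | yes q = cong (λ x → pathHeight c (col i) (suc x)) (toℕ-fromℕ< q)
  ... | no ¬q = ⊥-elim (¬q (s≤s⁻¹ l<k))

  height-sv : ∀ c j l → l ≤ r → height c (sv j l) ≡ 2 * k + l
  height-sv c j zero _ = sym (+-identityʳ (2 * k))
  height-sv c j (suc l) l<r with l <? r
  ... | yes q = cong (λ x → 2 * k + suc x) (toℕ-fromℕ< q)
  ... | no ¬q = ⊥-elim (¬q l<r)

  -- the other hub lies one step beyond the end of a P-path of the wrong colour
  far-hub : ∀ k₀ → suc (k₀ + suc (suc (suc k₀))) ≡ 2 * suc k₀ + 2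
  far-hub = solve-∀

  -- the three places where the height pattern changes
  near-X-x : ∀ c d → Near (suc k) (pathHeight c d 0)
  near-X-x colA colA = near-sym (near-suc k)
  near-X-x colB colB = near-sym (near-suc k)
  near-X-x colA colB = near-suc (suc k)
  near-X-x colB colA = near-suc (suc k)

  near-hub : ∀ c d → Near (pathHeight c d k₀) (hubHeight c d)
  near-hub colA colA = subst (λ x → Near x 0) (sym (m+n∸n≡m 1 k₀)) (near-sym (near-suc 0))
  near-hub colB colB = subst (λ x → Near x 0) (sym (m+n∸n≡m 1 k₀)) (near-sym (near-suc 0))
  near-hub colA colB = subst (Near _) (far-hub k₀) (near-suc _)
  near-hub colB colA = subst (Near _) (far-hub k₀) (near-suc _)

  2k∸k₀≡k+1 : 2 * k ∸ k₀ ≡ suc k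
  2k∸k₀≡k+1 = trans (cong (_∸ k₀) (split k₀)) (m+n∸m≡n k₀ (suc k))
    where split : ∀ k₀ → 2 * suc k₀ ≡ k₀ + suc (suc k₀)
          split = solve-∀

  near-path : ∀ c d l → l < k₀ → Near (pathHeight c d l) (pathHeight c d (suc l))
  near-path colA colA l l<k₀ = ∸-near k l (m<n⇒m<1+n l<k₀)
  near-path colB colB l l<k₀ = ∸-near k l (m<n⇒m<1+n l<k₀)
  near-path colA colB l _ = near-suc _
  near-path colB colA l _ = near-suc _

  near-KE : ∀ c → Lipschitz KE (height c)
  near-KE c (tpath i j p l l<k) with m≤n⇒m<n∨m≡n (s≤s⁻¹ l<k)
  ... | inj₁ l<k₀ = subst₂ Near (sym (height-tv c i j p l l<k)) (sym (height-tv c i j p (suc l) (s≤s l<k₀)))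
                      (∸-near (2 * k) l (≤-trans l<k (m≤m+n k (k + 0))))
  ... | inj₂ refl = subst₂ Near (sym (trans (height-tv c i j p k₀ l<k) 2k∸k₀≡k+1)) (cong (height c) (sym (tv-last i j p)))
                      (near-X-x c (col i))
  near-KE c (ppath i l l+1<k) = subst₂ Near (sym (height-pv c i l (<⇒≤ l+1<k))) (sym (height-pv c i (suc l) l+1<k))
                                  (near-path c (col i) l (s≤s⁻¹ l+1<k))
  near-KE c (xX i) = near-X-x c (col i)
  near-KE c (spath j l l<r) = subst₂ Near (sym (height-sv c j l (<⇒≤ l<r))) (sym (height-sv c j (suc l) l<r))
                                (+-near (2 * k) l)

  near-hub-edge : ∀ c d i → col i ≡ d → Near (height c (pv i k₀)) (hubHeight c d)
  near-hub-edge c d i refl = subst (λ x → Near x (hubHeight c (col i))) (sym (height-pv c i k₀ (n<1+n k₀)))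
                               (near-hub c (col i))

  height-lipschitz : ∀ c → Lipschitz H (height c)
  height-lipschitz c = lipschitz-sym {E = HE} {f = height c} near-HE
    where
    near-HE : Lipschitz HE (height c)
    near-HE (kE e) = near-KE c e
    near-HE (aE i eq) = near-hub-edge c colA i eq
    near-HE (bE i eq) = near-hub-edge c colB i eq

  from-hub : ∀ c {v ℓ} → Walk H (hub c) v ℓ → height c v ≤ ℓ
  from-hub colA = walk-bound (height-lipschitz colA)
  from-hub colB = walk-bound (height-lipschitz colB)

  heights-via-hub : ∀ {u v w a b} → IsHub w → Walk H u w a → Walk H w v b
    → Σ Colour λ c → height c u + height c v ≤ a + b
  heights-via-hub isA w₁ w₂ = colA , +-mono-≤ (from-hub colA (reverse w₁)) (from-hub colA w₂)
  heights-via-hub isB w₁ w₂ = colB , +-mono-≤ (from-hub colB (reverse w₁)) (from-hub colB w₂)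

  pathHeight-pos : ∀ c d l → l < k → 0 < pathHeight c d l
  pathHeight-pos colA colA l l<k = m<n⇒0<n∸m l<k
  pathHeight-pos colB colB l l<k = m<n⇒0<n∸m l<k
  pathHeight-pos colA colB l _ = ≤-trans (s≤s z≤n) (m≤n+m _ l)
  pathHeight-pos colB colA l _ = ≤-trans (s≤s z≤n) (m≤n+m _ l)

  height-pos : ∀ c w → ¬ IsHub w → 0 < height c w
  height-pos c AV ¬hub = ⊥-elim (¬hub isA)
  height-pos c BV ¬hub = ⊥-elim (¬hub isB)
  height-pos c XV _ = s≤s z≤n
  height-pos c (xV i) _ = pathHeight-pos c (col i) 0 (s≤s z≤n)
  height-pos c (pV i t) _ = pathHeight-pos c (col i) (suc (toℕ t)) (s≤s (toℕ<n t))
  height-pos c (tV i j p t) _ = m<n⇒0<n∸m (≤-trans (s≤s (toℕ<n t)) (m≤m+n k (k + 0)))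
  height-pos c (sV j) _ = s≤s z≤n
  height-pos c (slV j t) _ = s≤s z≤n

  near-hub-target : ∀ c v → height c v ≤ r → hub c ≢ v → Target v
  near-hub-target colA AV _ ne = ⊥-elim (ne refl)
  near-hub-target colB BV _ ne = ⊥-elim (ne refl)
  near-hub-target colB AV le _ with +-cancelˡ-≤ (2 * k) 2 1 le
  ... | s≤s ()
  near-hub-target colA BV le _ with +-cancelˡ-≤ (2 * k) 2 1 le
  ... | s≤s ()
  near-hub-target c XV _ _ = tX
  near-hub-target c (xV i) _ _ = tx i
  near-hub-target c (sV j) _ _ = tS j
  near-hub-target c (tV i j p t) _ _ = tT i j p t
  near-hub-target c (pV i t) _ _ = tP i t
  near-hub-target c (slV j Fin.zero) _ _ = tS1 j (s≤s z≤n)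
  near-hub-target c (slV j (Fin.suc t)) le _ with +-cancelˡ-≤ (2 * k) _ 1 le
  ... | s≤s ()

  hub-not-target : ∀ c → ¬ Target (hub c)
  hub-not-target colA ()
  hub-not-target colB ()

  x-to-p : ∀ i l → l < k → Walk K (xV i) (pv i l) l
  x-to-p i zero _ = nil
  x-to-p i (suc l) l+1<k = snoc (x-to-p i l (<⇒≤ l+1<k)) (inj₁ (ppath i l l+1<k))

  x-to-P : ∀ i (t : Fin k₀) → Walk K (xV i) (pV i t) (suc (toℕ t))
  x-to-P i t = subst (λ v → Walk K (xV i) v _) (pv-inner i t) (x-to-p i (suc (toℕ t)) (s≤s (toℕ<n t)))

  t-to-x : ∀ i j (p : i ∈ Ss j) l d → d + l ≡ k → Walk K (tv i j p l) (xV i) d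
  t-to-x i j p l zero refl = subst (λ v → Walk K v (xV i) 0) (sym (tv-last i j p)) nil
  t-to-x i j p l (suc d) eq =
    cons (inj₁ (tpath i j p l (subst (l <_) eq (m<n+m l (s≤s z≤n)))))
         (t-to-x i j p (suc l) d (trans (+-suc d l) eq))

  x-to-t : ∀ i j (p : i ∈ Ss j) l → l ≤ k → Walk K (xV i) (tv i j p l) (k ∸ l)
  x-to-t i j p l l≤k = reverse (t-to-x i j p l (k ∸ l) (m∸n+n≡m l≤k))

  x-to-S : ∀ i j → i ∈ Ss j → Walk K (xV i) (sV j) k
  x-to-S i j p = x-to-t i j p 0 z≤n

  x-to-T : ∀ i j .(p : i ∈ Ss j) (t : Fin k₀) → Walk K (xV i) (tV i j p t) (k ∸ suc (toℕ t))
  x-to-T i j p t = subst (λ v → Walk K (xV i) v _) (tv-inner i j p t)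
                     (x-to-t i j (recompute (i ∈? Ss j) p) (suc (toℕ t)) (s≤s (<⇒≤ (toℕ<n t))))

  s-to-sv : ∀ j l → l ≤ r → Walk K (sV j) (sv j l) l
  s-to-sv j zero _ = nil
  s-to-sv j (suc l) l<r = snoc (s-to-sv j l (<⇒≤ l<r)) (inj₁ (spath j l l<r))

  s-to-Sl : ∀ j (t : Fin r) → Walk K (sV j) (slV j t) (suc (toℕ t))
  s-to-Sl j t = subst (λ v → Walk K (sV j) v _) (sv-inner j t) (s-to-sv j (suc (toℕ t)) (toℕ<n t))

  -- Every non-hub w is reached from X in K within k steps, or (for the
  -- vertices S_j, S_j^{(l)} far from X) within height + 1 - k steps.
  FromX : V → Set
  FromX w = Σ ℕ λ e → Walk K XV w e × (e ≤ k ⊎ ∀ c → e + k ≤ suc (height c w))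

  from-X : ∀ w → ¬ IsHub w → FromX w
  from-X AV ¬hub = ⊥-elim (¬hub isA)
  from-X BV ¬hub = ⊥-elim (¬hub isB)
  from-X XV _ = 0 , nil , inj₁ z≤n
  from-X (xV i) _ = 1 , cons (inj₁ (xX i)) nil , inj₁ (s≤s z≤n)
  from-X (pV i t) _ = suc (suc (toℕ t)) , cons (inj₁ (xX i)) (x-to-P i t) , inj₁ (s≤s (toℕ<n t))
  from-X (tV i j p t) _ = suc (k₀ ∸ toℕ t) , cons (inj₁ (xX i)) (x-to-T i j p t) , inj₁ (s≤s (m∸n≤m k₀ (toℕ t)))
  from-X (sV j) _ with member colA j
  ... | i , i∈Sj , _ = suc k , cons (inj₁ (xX i)) (x-to-S i j i∈Sj) ,
                      inj₂ (λ _ → ≤-reflexive (cong suc (k+k≡2k k)))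
  from-X (slV j t) _ with member colA j
  ... | i , i∈Sj , _ = suc k + suc (toℕ t) , cons (inj₁ (xX i)) (x-to-S i j i∈Sj) ++ʷ s-to-Sl j t ,
                      inj₂ (λ _ → ≤-reflexive (far k (suc (toℕ t))))
    where far : ∀ k x → suc k + x + k ≡ suc (2 * k + x)
          far = solve-∀

  -- non-hubs whose heights above one hub sum to at most r are within
  -- distance r in K, routing through X
  via-X : ∀ c {u v} → ¬ IsHub u → ¬ IsHub v → height c u + height c v ≤ r → DistLe K r u v
  via-X c {u} {v} ¬hub-u ¬hub-v sum≤r with from-X u ¬hub-u | from-X v ¬hub-v
  ... | a , wa , legA | b , wb , legB =
    a + b ,
    legs-fit k (s≤s z≤n) (height-pos c u ¬hub-u) (height-pos c v ¬hub-v) sum≤r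
      (⊎-map₂ (λ far → far c) legA) (⊎-map₂ (λ far → far c) legB) ,
    reverse wa ++ʷ wb

  hub-edge : ∀ c i → col i ≡ c → HE (pv i k₀) (hub c)
  hub-edge colA i eq = aE i eq
  hub-edge colB i eq = bE i eq

  hub-to-x : ∀ c i → col i ≡ c → Walk H (hub c) (xV i) k
  hub-to-x c i eq = reverse (snoc (map-walk kH (x-to-p i k₀ (n<1+n k₀))) (inj₁ (hub-edge c i eq)))

  hub-to-X : ∀ c → Walk H (hub c) XV (suc k)
  hub-to-X c with member c j₀
  ... | i , _ , eq = snoc (hub-to-x c i eq) (inj₂ (kE (xX i)))

  hub-to-any-x : ∀ c i → Walk H (hub c) (xV i) (suc (suc k))
  hub-to-any-x c i = snoc (hub-to-X c) (inj₁ (kE (xX i)))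

  hub-to-S : ∀ c j → Walk H (hub c) (sV j) (k + k)
  hub-to-S c j with member c j
  ... | i , i∈Sj , eq = hub-to-x c i eq ++ʷ map-walk kH (x-to-S i j i∈Sj)

  x-leg-bound : ∀ d → d ≤ k₀ → suc (suc k) + d ≤ r
  x-leg-bound d d≤k₀ = ≤-trans (+-monoʳ-≤ (suc (suc k)) d≤k₀) (≤-reflexive (total k₀))
    where total : ∀ k₀ → suc (suc (suc k₀)) + k₀ ≡ 2 * suc k₀ + 1
          total = solve-∀

  x-bound : suc (suc k) ≤ r
  x-bound = subst (_≤ r) (+-identityʳ _) (x-leg-bound 0 z≤n)

  hub-reach : ∀ c {v} → Target v → DistLe H r (hub c) v
  hub-reach c tX = suc k , ≤-trans (n≤1+n _) x-bound , hub-to-X c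
  hub-reach c (tx i) = suc (suc k) , x-bound , hub-to-any-x c i
  hub-reach c (tS j) = k + k , ≤-trans (n≤1+n _) (≤-reflexive (sym (r≡ k))) , hub-to-S c j
  hub-reach c (tT i j p t) = suc (suc k) + (k₀ ∸ toℕ t) , x-leg-bound _ (m∸n≤m k₀ (toℕ t)) ,
    hub-to-any-x c i ++ʷ map-walk kH (x-to-T i j p t)
  hub-reach c (tP i t) = suc (suc k) + suc (toℕ t) , x-leg-bound _ (toℕ<n t) ,
    hub-to-any-x c i ++ʷ map-walk kH (x-to-P i t)
  hub-reach c (tS1 j _) = suc (k + k) , ≤-reflexive (sym (r≡ k)) ,
    snoc (hub-to-S c j) (inj₁ (kE (spath j 0 (s≤s z≤n))))

  power-sym : ∀ {u v} → Power H r u v → Power H r v u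
  power-sym (ne , ℓ , ℓ≤r , w) = ne ∘ sym , ℓ , ℓ≤r , reverse w

  hub-power : ∀ c {v} → Target v → Power H r (hub c) v
  hub-power c t = (λ eq → hub-not-target c (subst Target (sym eq) t)) , hub-reach c t

  E-in-power : ∀ {u v} → EE u v → Power H r u v
  E-in-power (aT t) = hub-power colA t
  E-in-power (bT t) = hub-power colB t

  G⊆Hʳ : ∀ u v → G u v → Power H r u v
  G⊆Hʳ u v (inj₁ (ne , ℓ , ℓ≤r , w)) = ne , ℓ , ℓ≤r , map-walk kH w
  G⊆Hʳ u v (inj₂ (inj₁ e)) = E-in-power e
  G⊆Hʳ u v (inj₂ (inj₂ e)) = power-sym (E-in-power e)

  hub-walk : ∀ {u v ℓ} → IsHub u → u ≢ v → ℓ ≤ r → Walk H u v ℓ → EE u v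
  hub-walk isA ne ℓ≤r w = aT (near-hub-target colA _ (≤-trans (from-hub colA w) ℓ≤r) ne)
  hub-walk isB ne ℓ≤r w = bT (near-hub-target colB _ (≤-trans (from-hub colB w) ℓ≤r) ne)

  shortcut : ∀ {u v ℓ} → ¬ IsHub u → ¬ IsHub v → ℓ ≤ r → Walk H u v ℓ → DistLe K r u v
  shortcut {ℓ = ℓ} ¬hub-u ¬hub-v ℓ≤r w with avoid-or-visit isHub? restrict-H ¬hub-u w
  ... | inj₁ kw = ℓ , ℓ≤r , kw
  ... | inj₂ (visit hub w₁ w₂) with heights-via-hub hub w₁ w₂
  ...   | c , sum≤ℓ = via-X c ¬hub-u ¬hub-v (≤-trans sum≤ℓ ℓ≤r)

  Hʳ⊆G : ∀ u v → Power H r u v → G u v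
  Hʳ⊆G u v (ne , ℓ , ℓ≤r , w) with isHub? u | isHub? v
  ... | yes hub-u | _ = inj₂ (inj₁ (hub-walk hub-u ne ℓ≤r w))
  ... | no _ | yes hub-v = inj₂ (inj₂ (hub-walk hub-v (ne ∘ sym) ℓ≤r (reverse w)))
  ... | no ¬hub-u | no ¬hub-v = inj₁ (ne , shortcut ¬hub-u ¬hub-v ℓ≤r w)

lemma6 : (k n m : ℕ) → 1 ≤ k → 1 ≤ m
    → (Ss : Fin m → Subset n) → (col : Fin n → Colour)
    → (∀ j → Σ (Fin n) (λ i → i ∈ Ss j × col i ≡ colA))
    → (∀ j → Σ (Fin n) (λ i → i ∈ Ss j × col i ≡ colB))
    → ∀ u v → Construction.G k n m Ss col u v ⇔ Power (Construction.H k n m Ss col) (Construction.r k n m Ss col) u v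
lemma6 (suc k₀) n m _ m≥1 Ss col hA hB u v = mk⇔ (G⊆Hʳ u v) (Hʳ⊆G u v)
  where open Proof k₀ n m Ss col hA hB (fromℕ< m≥1)
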